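{- Every term of $\lambda^{\Box\rightarrow\wedge\vee\bot}$ is strongly normalizing with respect to the $\bot$-conversions $>_\bot$.
   Context: Terms of $\lambda^{\Box\rightarrow\wedge\vee\bot}$ (proof terms of the natural deduction system $\mathsf{IEL}^{ - }$ for intuitionistic belief): $x\mid \lambda x.t\mid ts\mid \langle t,s\rangle\mid \pi_1 t\mid \pi_2 t\mid \mathsf{in}_1 t\mid \mathsf{in}_2 t\mid \mathsf{C}_{x,y}(t,t_1,t_2)\mid \mathsf{E}(t)\mid \mathsf{B}_{x_1,\dots,x_n}(t_1,\dots,t_n)\,\mathsf{in}\,s$, where $\mathsf{E}$ is $\bot$-elimination and $\mathsf{B}$ (binding $x_1,\dots,x_n$ in $s$) is $\Box$-introduction. $\bot$-conversions $>_\bot$ (closed under term contexts): $\mathsf{E}(t)s>\mathsf{E}(t)$; $\pi_i\mathsf{E}(t)>\mathsf{E}(t)$ ($i=1,2$); $\mathsf{C}_{x,y}(\mathsf{E}(t),t_1,t_2)>\mathsf{E}(t)$; $\mathsf{E}(\mathsf{E}(t))>\mathsf{E}(t)$; $\mathsf{B}_{x_1,\dots,x_n}(t_1,\dots,t_{i-1},\mathsf{E}(t_i),t_{i+1},\dots,t_n)\,\mathsf{in}\,s>\mathsf{E}(t_i)$. -}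

module Defs where

open import Data.Nat using (ℕ)
open import Data.Fin using (Fin)
open import Data.Vec using (Vec; lookup; _[_]≔_)
open import Relation.Binary.PropositionalEquality using (_≡_)
open import Induction.WellFounded using (Acc)

-- Variables are named by natural numbers (the ⊥-conversions involve no
-- substitution, so named variables suffice).
Var : Set
Var = ℕ

data Term : Set where
  var  : Var → Term
  lam  : Var → Term → Term
  app  : Term → Term → Term
  pair : Term → Term → Term
  π₁   : Term → Term
  π₂   : Term → Term
  in₁  : Term → Term
  in₂  : Term → Term
  case : Var → Var → Term → Term → Term → Term
  E    : Term → Term                                -- ⊥-elimination
  B    : (n : ℕ) → Vec Var n → Vec Term n → Term → Term

infix 4 _>⊥_
data _>⊥_ : Term → Term → Set where
  app-E  : ∀ t s → app (E t) s >⊥ E t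
  π₁-E   : ∀ t → π₁ (E t) >⊥ E t
  π₂-E   : ∀ t → π₂ (E t) >⊥ E t
  case-E : ∀ x y t t₁ t₂ → case x y (E t) t₁ t₂ >⊥ E t
  E-E    : ∀ t → E (E t) >⊥ E t
  B-E    : ∀ n xs ts s (i : Fin n) t → lookup ts i ≡ E t → B n xs ts s >⊥ E t
  lam-c   : ∀ x {t t'} → t >⊥ t' → lam x t >⊥ lam x t'
  appˡ    : ∀ {t t'} s → t >⊥ t' → app t s >⊥ app t' s
  appʳ    : ∀ t {s s'} → s >⊥ s' → app t s >⊥ app t s'
  pairˡ   : ∀ {t t'} s → t >⊥ t' → pair t s >⊥ pair t' s
  pairʳ   : ∀ t {s s'} → s >⊥ s' → pair t s >⊥ pair t s'
  π₁-c    : ∀ {t t'} → t >⊥ t' → π₁ t >⊥ π₁ t'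
  π₂-c    : ∀ {t t'} → t >⊥ t' → π₂ t >⊥ π₂ t'
  in₁-c   : ∀ {t t'} → t >⊥ t' → in₁ t >⊥ in₁ t'
  in₂-c   : ∀ {t t'} → t >⊥ t' → in₂ t >⊥ in₂ t'
  case-c₀ : ∀ x y {t t'} t₁ t₂ → t >⊥ t' → case x y t t₁ t₂ >⊥ case x y t' t₁ t₂
  case-c₁ : ∀ x y t {t₁ t₁'} t₂ → t₁ >⊥ t₁' → case x y t t₁ t₂ >⊥ case x y t t₁' t₂
  case-c₂ : ∀ x y t t₁ {t₂ t₂'} → t₂ >⊥ t₂' → case x y t t₁ t₂ >⊥ case x y t t₁ t₂'
  E-c     : ∀ {t t'} → t >⊥ t' → E t >⊥ E t'
  B-arg   : ∀ n xs ts s (i : Fin n) {t'} → lookup ts i >⊥ t' →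
            B n xs ts s >⊥ B n xs (ts [ i ]≔ t') s
  B-body  : ∀ n xs ts {s s'} → s >⊥ s' → B n xs ts s >⊥ B n xs ts s'

_<⊥_ : Term → Term → Set
u <⊥ t = t >⊥ u

SN : Term → Set
SN t = Acc _<⊥_ t

module Submission where

open import Defs
open import Data.Nat using (ℕ; suc; _+_; _<_; _≤_; s≤s)
open import Data.Nat.Properties
open import Data.Nat.Induction using (<-wellFounded)
open import Data.Fin using (Fin; zero; suc)
open import Data.Vec using (Vec; []; _∷_; lookup; _[_]≔_)
open import Function using (_on_)
open import Relation.Binary.PropositionalEquality using (subst)
open import Induction.WellFounded using (WellFounded; module Subrelation)
import Relation.Binary.Construct.On as On

-- Every ⊥-conversion replaces a term by one of its proper subterms, so the
-- number of constructors strictly decreases along >⊥; reduction is thus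
-- contained in the well-founded relation "smaller size".

mutual
  size : Term → ℕ
  size (var x) = 1
  size (lam x t) = suc (size t)
  size (app t s) = suc (size t + size s)
  size (pair t s) = suc (size t + size s)
  size (π₁ t) = suc (size t)
  size (π₂ t) = suc (size t)
  size (in₁ t) = suc (size t)
  size (in₂ t) = suc (size t)
  size (case x y t t₁ t₂) = suc (size t + size t₁ + size t₂)
  size (E t) = suc (size t)
  size (B n xs ts s) = suc (sizes ts + size s)

  sizes : ∀ {n} → Vec Term n → ℕ
  sizes [] = 0
  sizes (t ∷ ts) = size t + sizes ts

size-lookup≤sizes : ∀ {n} (ts : Vec Term n) (i : Fin n) → size (lookup ts i) ≤ sizes ts
size-lookup≤sizes (t ∷ ts) zero = m≤m+n (size t) (sizes ts)
size-lookup≤sizes (t ∷ ts) (suc i) = ≤-trans (size-lookup≤sizes ts i) (m≤n+m (sizes ts) (size t))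

sizes-update-< : ∀ {n} (ts : Vec Term n) (i : Fin n) t' → size t' < size (lookup ts i) →
                 sizes (ts [ i ]≔ t') < sizes ts
sizes-update-< (t ∷ ts) zero t' p = +-monoˡ-< (sizes ts) p
sizes-update-< (t ∷ ts) (suc i) t' p = +-monoʳ-< (size t) (sizes-update-< ts i t' p)

>⊥⇒size-< : ∀ {t u} → t >⊥ u → size u < size t
>⊥⇒size-< (app-E t s) = s≤s (s≤s (m≤m+n (size t) (size s)))
>⊥⇒size-< (π₁-E t) = s≤s ≤-refl
>⊥⇒size-< (π₂-E t) = s≤s ≤-refl
>⊥⇒size-< (case-E x y t t₁ t₂) = s≤s (s≤s (≤-trans (m≤m+n (size t) (size t₁)) (m≤m+n _ (size t₂))))
>⊥⇒size-< (E-E t) = s≤s ≤-refl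
>⊥⇒size-< (B-E n xs ts s i t eq) =
  s≤s (≤-trans (subst (λ u → size u ≤ sizes ts) eq (size-lookup≤sizes ts i)) (m≤m+n (sizes ts) (size s)))
>⊥⇒size-< (lam-c x r) = s≤s (>⊥⇒size-< r)
>⊥⇒size-< (appˡ s r) = s≤s (+-monoˡ-< (size s) (>⊥⇒size-< r))
>⊥⇒size-< (appʳ t r) = s≤s (+-monoʳ-< (size t) (>⊥⇒size-< r))
>⊥⇒size-< (pairˡ s r) = s≤s (+-monoˡ-< (size s) (>⊥⇒size-< r))
>⊥⇒size-< (pairʳ t r) = s≤s (+-monoʳ-< (size t) (>⊥⇒size-< r))
>⊥⇒size-< (π₁-c r) = s≤s (>⊥⇒size-< r)
>⊥⇒size-< (π₂-c r) = s≤s (>⊥⇒size-< r)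
>⊥⇒size-< (in₁-c r) = s≤s (>⊥⇒size-< r)
>⊥⇒size-< (in₂-c r) = s≤s (>⊥⇒size-< r)
>⊥⇒size-< (case-c₀ x y t₁ t₂ r) = s≤s (+-monoˡ-< (size t₂) (+-monoˡ-< (size t₁) (>⊥⇒size-< r)))
>⊥⇒size-< (case-c₁ x y t t₂ r) = s≤s (+-monoˡ-< (size t₂) (+-monoʳ-< (size t) (>⊥⇒size-< r)))
>⊥⇒size-< (case-c₂ x y t t₁ r) = s≤s (+-monoʳ-< (size t + size t₁) (>⊥⇒size-< r))
>⊥⇒size-< (E-c r) = s≤s (>⊥⇒size-< r)
>⊥⇒size-< (B-arg n xs ts s i r) = s≤s (+-monoˡ-< (size s) (sizes-update-< ts i _ (>⊥⇒size-< r)))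
>⊥⇒size-< (B-body n xs ts {s} r) = s≤s (+-monoʳ-< (sizes ts) (>⊥⇒size-< r))

proposition22 : (t : Term) → SN t
proposition22 = Subrelation.wellFounded >⊥⇒size-< size-<-wellFounded
  where
  size-<-wellFounded : WellFounded (_<_ on size)
  size-<-wellFounded = On.wellFounded size <-wellFounded
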